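{- Let $a$ be a positive integer. (a) For any integer $k$ with $\lceil\frac a2\rceil\le k\le a$, \[ \sum_{x=a-k}^{\lfloor\frac a2\rfloor}(a-2x)\binom{a-x}{k-x}\binom{k}{a-x}=\left\lceil\tfrac{2k-a}{2}\right\rceil\binom{2k-a}{\lceil\frac{2k-a}{2}\rceil}\binom{k}{2k-a}. \] (b) For any integer $k$ with $\lceil\frac a2\rceil+1\le k\le a$, \[ \sum_{x=a-k+1}^{\lfloor\frac a2\rfloor}(a-2x)\binom{a-x}{k-x}\binom{k-1}{a-x}=\left\{\frac{2k-a}{2}\binom{2k-a-1}{\lceil\frac{2k-a-1}{2}\rceil}-2^{2k-a-2}\right\}\binom{k-1}{2k-a-1}. \]
   Context: $\lfloor x\rfloor$ is the greatest integer $\le x$ and $\lceil x\rceil$ the least integer $\ge x$; $\binom{m}{k}$ denotes the usual binomial coefficient (zero when $k>m\ge0$). -}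

module Defs where

open import Data.Nat using (ℕ; zero; suc; _+_; _∸_)

-- sumFromTo f m n = Σ_{x=m}^{n} f x  (empty sum, i.e. 0, when m > n)
sumFromTo : (ℕ → ℕ) → ℕ → ℕ → ℕ
sumFromTo f m n = go (suc n ∸ m)
  where
  go : ℕ → ℕ
  go zero    = 0
  go (suc i) = go i + f (m + i)

-- With j = a - k and m = 2k - a we have a = 2j + m and k = j + m.  Substituting x = j + t and
-- using the trinomial revision C(j+i,i) C(j+M,j+i) = C(j+M,M) C(M,i), every summand factors as
-- C(k,m) (resp. C(k-1,m-1)) times a term of row m (resp. row n = m-1) of Pascal's triangle.
-- Part (a) is then the telescoping sum  Σ_{t<N} (m-2t) C(m,t) = N C(m,N),  valid while
-- 2(N-1) ≤ m, whose step is the absorption identity (m-t) C(m,t) = (t+1) C(m,t+1).  In part (b),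
-- n-1-2t = (n-2t) - 1 turns the sum into the same telescoping sum minus the lower half of row n,
-- and the two halves of that row add up to 2^n.
module Submission where

open import Defs
open import Data.Nat using (ℕ; _+_; _*_; _∸_; _^_; _≤_; ⌊_/2⌋; ⌈_/2⌉)
open import Data.Nat.Combinatorics using (_C_)
open import Data.Integer using (+_)
open import Data.Rational using (ℚ; _/_; _-_) renaming (_*_ to _*ℚ_)
open import Data.Product using (_×_)
open import Relation.Binary.PropositionalEquality using (_≡_)

open import Data.Nat using (zero; suc; _<_; _!; s≤s; s≤s⁻¹)
open import Data.Nat.Properties
open import Data.Nat.Combinatorics
  using (nCk+nC[k+1]≡[n+1]C[k+1]; nCk≡nC[n∸k]; k>n⇒nCk≡0; nC1≡n; nCk≡n!/k![n-k]!; k![n∸k]!∣n!)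
open import Data.Nat.DivMod using (m/n*n≡m)
open import Data.Nat.Tactic.RingSolver using (solve-∀)
open import Data.Integer as ℤ using (ℤ)
open import Data.Integer.Properties using (pos-+; pos-*)
import Data.Integer.Tactic.RingSolver as ℤ-Solver
open import Data.Rational using (toℚᵘ) renaming (-_ to -ℚ_)
open import Data.Rational.Properties
  using (toℚᵘ-injective; toℚᵘ-fromℚᵘ; toℚᵘ-homo-*; toℚᵘ-homo-+; toℚᵘ-homo‿-)
import Data.Rational.Unnormalised as ℚᵘ
import Data.Rational.Unnormalised.Properties as ℚᵘ
open import Data.Sum using (_⊎_; inj₁; inj₂; [_,_]′)
import Data.Sum as Sum
open import Data.Product using (_,_)
open import Relation.Nullary using (yes; no)
open import Relation.Binary.PropositionalEquality
  using (refl; sym; trans; cong; cong₂; subst₂; module ≡-Reasoning)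

⌈n/2⌉≡⌊n/2⌋⊎⌈n/2⌉≡1+⌊n/2⌋ : ∀ n → ⌈ n /2⌉ ≡ ⌊ n /2⌋ ⊎ ⌈ n /2⌉ ≡ suc ⌊ n /2⌋
⌈n/2⌉≡⌊n/2⌋⊎⌈n/2⌉≡1+⌊n/2⌋ zero          = inj₁ refl
⌈n/2⌉≡⌊n/2⌋⊎⌈n/2⌉≡1+⌊n/2⌋ (suc zero)    = inj₂ refl
⌈n/2⌉≡⌊n/2⌋⊎⌈n/2⌉≡1+⌊n/2⌋ (suc (suc n)) = Sum.map (cong suc) (cong suc) (⌈n/2⌉≡⌊n/2⌋⊎⌈n/2⌉≡1+⌊n/2⌋ n)

⌈n/2⌉≤1+⌊n/2⌋ : ∀ n → ⌈ n /2⌉ ≤ suc ⌊ n /2⌋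
⌈n/2⌉≤1+⌊n/2⌋ n = [ (λ c≡f → ≤-trans (≤-reflexive c≡f) (n≤1+n _)) , ≤-reflexive ]′
  (⌈n/2⌉≡⌊n/2⌋⊎⌈n/2⌉≡1+⌊n/2⌋ n)

2*m≡m+m : ∀ m → 2 * m ≡ m + m
2*m≡m+m m = cong (_+_ m) (+-identityʳ m)

2*⌊n/2⌋≤n : ∀ n → 2 * ⌊ n /2⌋ ≤ n
2*⌊n/2⌋≤n n = begin
  2 * ⌊ n /2⌋           ≡⟨ 2*m≡m+m ⌊ n /2⌋ ⟩
  ⌊ n /2⌋ + ⌊ n /2⌋     ≤⟨ +-monoʳ-≤ ⌊ n /2⌋ (⌊n/2⌋≤⌈n/2⌉ n) ⟩
  ⌊ n /2⌋ + ⌈ n /2⌉     ≡⟨ ⌊n/2⌋+⌈n/2⌉≡n n ⟩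
  n                     ∎
  where open ≤-Reasoning

n≤2*⌈n/2⌉ : ∀ n → n ≤ 2 * ⌈ n /2⌉
n≤2*⌈n/2⌉ n = begin
  n                     ≡⟨ ⌊n/2⌋+⌈n/2⌉≡n n ⟨
  ⌊ n /2⌋ + ⌈ n /2⌉     ≤⟨ +-monoˡ-≤ ⌈ n /2⌉ (⌊n/2⌋≤⌈n/2⌉ n) ⟩
  ⌈ n /2⌉ + ⌈ n /2⌉     ≡⟨ 2*m≡m+m ⌈ n /2⌉ ⟨
  2 * ⌈ n /2⌉           ∎
  where open ≤-Reasoning

t<⌈n/2⌉⇒1+2t≤n : ∀ {n t} → t < ⌈ n /2⌉ → suc (2 * t) ≤ n
t<⌈n/2⌉⇒1+2t≤n {n} {t} t<⌈n/2⌉ = s≤s⁻¹ (begin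
  2 + 2 * t       ≡⟨ *-suc 2 t ⟨
  2 * suc t       ≤⟨ *-monoʳ-≤ 2 t<⌈n/2⌉ ⟩
  2 * ⌈ n /2⌉     ≤⟨ 2*⌊n/2⌋≤n (suc n) ⟩
  suc n           ∎)
  where open ≤-Reasoning

n∸⌊n/2⌋≡⌈n/2⌉ : ∀ n → n ∸ ⌊ n /2⌋ ≡ ⌈ n /2⌉
n∸⌊n/2⌋≡⌈n/2⌉ n = trans (cong (_∸ ⌊ n /2⌋) (sym (⌊n/2⌋+⌈n/2⌉≡n n))) (m+n∸m≡n ⌊ n /2⌋ ⌈ n /2⌉)

⌈n/2⌉≤k⇒n≤2*k : ∀ {n k} → ⌈ n /2⌉ ≤ k → n ≤ 2 * k
⌈n/2⌉≤k⇒n≤2*k {n} ⌈n/2⌉≤k = ≤-trans (n≤2*⌈n/2⌉ n) (*-monoʳ-≤ 2 ⌈n/2⌉≤k)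

⌈n/2⌉+1≤k⇒2+n≤2*k : ∀ {n k} → ⌈ n /2⌉ + 1 ≤ k → 2 + n ≤ 2 * k
⌈n/2⌉+1≤k⇒2+n≤2*k {n} {k} ⌈n/2⌉+1≤k = begin
  2 + n                ≤⟨ +-monoʳ-≤ 2 (n≤2*⌈n/2⌉ n) ⟩
  2 + 2 * ⌈ n /2⌉      ≡⟨ *-suc 2 ⌈ n /2⌉ ⟨
  2 * suc ⌈ n /2⌉      ≡⟨ cong (_*_ 2) (+-comm 1 ⌈ n /2⌉) ⟩
  2 * (⌈ n /2⌉ + 1)    ≤⟨ *-monoʳ-≤ 2 ⌈n/2⌉+1≤k ⟩
  2 * k                ∎
  where open ≤-Reasoning

⌊j+j+m/2⌋≡j+⌊m/2⌋ : ∀ j m → ⌊ j + j + m /2⌋ ≡ j + ⌊ m /2⌋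
⌊j+j+m/2⌋≡j+⌊m/2⌋ zero    m = refl
⌊j+j+m/2⌋≡j+⌊m/2⌋ (suc j) m rewrite +-suc j j = cong suc (⌊j+j+m/2⌋≡j+⌊m/2⌋ j m)

2t+2pb≡mdb⇒t≡[m/2*d-p]*b : ∀ (t m d p b : ℤ) →
  + 2 ℤ.* t ℤ.+ + 2 ℤ.* p ℤ.* b ≡ m ℤ.* d ℤ.* b →
  t / 1 ≡ ((m / 2) *ℚ (d / 1) - p / 1) *ℚ (b / 1)
2t+2pb≡mdb⇒t≡[m/2*d-p]*b t m d p b eq = toℚᵘ-injective (begin
  toℚᵘ (t / 1)                                    ≈⟨ toℚᵘ-fromℚᵘ ⟦ t ⟧ ⟩
  ⟦ t ⟧                                           ≈⟨ ℚᵘ.*≡* cross-multiplied ⟩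
  ((⟦m/2⟧ ℚᵘ.* ⟦ d ⟧) ℚᵘ.- ⟦ p ⟧) ℚᵘ.* ⟦ b ⟧      ≈⟨ toℚᵘ-rhs ⟨
  toℚᵘ (((m / 2) *ℚ (d / 1) - p / 1) *ℚ (b / 1))  ∎)
  where
  open ℚᵘ.≃-Reasoning
  ⟦_⟧ : ℤ → ℚᵘ.ℚᵘ
  ⟦ x ⟧ = ℚᵘ.mkℚᵘ x 0
  ⟦m/2⟧ : ℚᵘ.ℚᵘ
  ⟦m/2⟧ = ℚᵘ.mkℚᵘ m 1
  -- ℚᵘ's _≃_ unfolded, with the numerator and denominator of the right side as computed.
  cross-multiplied : t ℤ.* + 2 ≡ ((m ℤ.* d ℤ.* + 1 ℤ.+ ℤ.- p ℤ.* + 2) ℤ.* b) ℤ.* + 1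
  cross-multiplied = trans (isolate t p b) (trans (cong (ℤ._- + 2 ℤ.* p ℤ.* b) eq) (expand m d p b))
    where
    isolate : ∀ t p b → t ℤ.* + 2 ≡ (+ 2 ℤ.* t ℤ.+ + 2 ℤ.* p ℤ.* b) ℤ.- + 2 ℤ.* p ℤ.* b
    isolate = ℤ-Solver.solve-∀
    expand : ∀ m d p b →
      m ℤ.* d ℤ.* b ℤ.- + 2 ℤ.* p ℤ.* b ≡ ((m ℤ.* d ℤ.* + 1 ℤ.+ ℤ.- p ℤ.* + 2) ℤ.* b) ℤ.* + 1
    expand = ℤ-Solver.solve-∀
  toℚᵘ-rhs :
    toℚᵘ (((m / 2) *ℚ (d / 1) - p / 1) *ℚ (b / 1)) ℚᵘ.≃ ((⟦m/2⟧ ℚᵘ.* ⟦ d ⟧) ℚᵘ.- ⟦ p ⟧) ℚᵘ.* ⟦ b ⟧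
  toℚᵘ-rhs = begin
    toℚᵘ (((m / 2) *ℚ (d / 1) - p / 1) *ℚ (b / 1))
      ≈⟨ toℚᵘ-homo-* ((m / 2) *ℚ (d / 1) - p / 1) (b / 1) ⟩
    toℚᵘ ((m / 2) *ℚ (d / 1) - p / 1) ℚᵘ.* toℚᵘ (b / 1)
      ≈⟨ ℚᵘ.*-cong (toℚᵘ-homo-+ ((m / 2) *ℚ (d / 1)) (-ℚ (p / 1))) (toℚᵘ-fromℚᵘ ⟦ b ⟧) ⟩
    (toℚᵘ ((m / 2) *ℚ (d / 1)) ℚᵘ.+ toℚᵘ (-ℚ (p / 1))) ℚᵘ.* ⟦ b ⟧
      ≈⟨ ℚᵘ.*-congʳ (ℚᵘ.+-cong (toℚᵘ-homo-* (m / 2) (d / 1)) (toℚᵘ-homo‿- (p / 1))) ⟩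
    (toℚᵘ (m / 2) ℚᵘ.* toℚᵘ (d / 1) ℚᵘ.- toℚᵘ (p / 1)) ℚᵘ.* ⟦ b ⟧
      ≈⟨ ℚᵘ.*-congʳ (ℚᵘ.+-cong (ℚᵘ.*-cong (toℚᵘ-fromℚᵘ ⟦m/2⟧) (toℚᵘ-fromℚᵘ ⟦ d ⟧))
                                (ℚᵘ.-‿cong (toℚᵘ-fromℚᵘ ⟦ p ⟧))) ⟩
    ((⟦m/2⟧ ℚᵘ.* ⟦ d ⟧) ℚᵘ.- ⟦ p ⟧) ℚᵘ.* ⟦ b ⟧    ∎

2T+2PB≡mDB⇒T≡[m/2*D-P]*B : ∀ T m D P B → 2 * T + 2 * P * B ≡ m * D * B →
  (+ T) / 1 ≡ (((+ m) / 2) *ℚ ((+ D) / 1) - (+ P) / 1) *ℚ ((+ B) / 1)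
2T+2PB≡mDB⇒T≡[m/2*D-P]*B T m D P B eq = 2t+2pb≡mdb⇒t≡[m/2*d-p]*b (+ T) (+ m) (+ D) (+ P) (+ B) (begin
  + 2 ℤ.* + T ℤ.+ + 2 ℤ.* + P ℤ.* + B
    ≡⟨ cong₂ ℤ._+_ (pos-* 2 T) (trans (pos-* (2 * P) B) (cong (ℤ._* + B) (pos-* 2 P))) ⟨
  + (2 * T) ℤ.+ + (2 * P * B)     ≡⟨ pos-+ (2 * T) (2 * P * B) ⟨
  + (2 * T + 2 * P * B)           ≡⟨ cong +_ eq ⟩
  + (m * D * B)                   ≡⟨ trans (pos-* (m * D) B) (cong (ℤ._* + B) (pos-* m D)) ⟩
  + m ℤ.* + D ℤ.* + B             ∎)
  where open ≡-Reasoning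

open ≡-Reasoning

∑< : ℕ → (ℕ → ℕ) → ℕ
∑< zero    f = 0
∑< (suc n) f = ∑< n f + f n

syntax ∑< n (λ t → e) = ∑[ t < n ] e

∑-cong : ∀ n {f g : ℕ → ℕ} → (∀ t → t < n → f t ≡ g t) → ∑< n f ≡ ∑< n g
∑-cong zero    f≗g = refl
∑-cong (suc n) f≗g =
  cong₂ _+_ (∑-cong n (λ t t<n → f≗g t (m<n⇒m<1+n t<n))) (f≗g n ≤-refl)

∑-distrib-+ : ∀ n (f g : ℕ → ℕ) → ∑[ t < n ] (f t + g t) ≡ ∑< n f + ∑< n g
∑-distrib-+ zero    f g = refl
∑-distrib-+ (suc n) f g = begin
  ∑[ t < n ] (f t + g t) + (f n + g n)  ≡⟨ cong (_+ (f n + g n)) (∑-distrib-+ n f g) ⟩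
  ∑< n f + ∑< n g + (f n + g n)         ≡⟨ +-interchange (∑< n f) (∑< n g) (f n) (g n) ⟩
  ∑< n f + f n + (∑< n g + g n)         ∎
  where
  +-interchange : ∀ w x y z → w + x + (y + z) ≡ w + y + (x + z)
  +-interchange = solve-∀

∑-distribʳ-* : ∀ n c (f : ℕ → ℕ) → ∑[ t < n ] (f t * c) ≡ ∑< n f * c
∑-distribʳ-* zero    c f = refl
∑-distribʳ-* (suc n) c f =
  trans (cong (_+ f n * c) (∑-distribʳ-* n c f)) (sym (*-distribʳ-+ c (∑< n f) (f n)))

∑-split : ∀ m n (f : ℕ → ℕ) → ∑< (m + n) f ≡ ∑< m f + ∑[ t < n ] f (m + t)
∑-split m zero    f = trans (cong (λ N → ∑< N f) (+-identityʳ m)) (sym (+-identityʳ _))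
∑-split m (suc n) f rewrite +-suc m n | ∑-split m n f = +-assoc (∑< m f) _ _

∑-reverse : ∀ n (f : ℕ → ℕ) → ∑< n f ≡ ∑[ t < n ] f (n ∸ suc t)
∑-reverse zero    f = refl
∑-reverse (suc n) f = begin
  ∑< n f + f n                        ≡⟨ cong (_+ f n) (∑-reverse n f) ⟩
  ∑[ t < n ] f (n ∸ suc t) + f n      ≡⟨ +-comm _ (f n) ⟩
  f n + ∑[ t < n ] f (n ∸ suc t)      ≡⟨ ∑-split 1 n (λ t → f (suc n ∸ suc t)) ⟨
  ∑[ t < suc n ] f (suc n ∸ suc t)    ∎

sumFromTo≡∑ : ∀ f m n → sumFromTo f m n ≡ ∑[ t < suc n ∸ m ] f (m + t)
sumFromTo≡∑ f zero          zero = refl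
sumFromTo≡∑ f (suc zero)    zero = refl
sumFromTo≡∑ f (suc (suc m)) zero = refl
sumFromTo≡∑ f m (suc n) with m ≤? suc n
... | no  m≰1+n rewrite m≤n⇒m∸n≡0 {suc (suc n)} {m} (≰⇒> m≰1+n) = refl
... | yes m≤1+n rewrite +-∸-assoc 1 m≤1+n =
  cong (_+ f (m + (suc n ∸ m))) (sumFromTo≡∑ f m n)

sumFromTo[m,m+n]≡∑ : ∀ f m n → sumFromTo f m (m + n) ≡ ∑[ t < suc n ] f (m + t)
sumFromTo[m,m+n]≡∑ f m n = begin
  sumFromTo f m (m + n)               ≡⟨ sumFromTo≡∑ f m (m + n) ⟩
  ∑[ t < suc (m + n) ∸ m ] f (m + t)  ≡⟨ cong (λ N → ∑[ t < N ∸ m ] f (m + t)) (+-suc m n) ⟨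
  ∑[ t < m + suc n ∸ m ] f (m + t)    ≡⟨ cong (λ N → ∑[ t < N ] f (m + t)) (m+n∸m≡n m (suc n)) ⟩
  ∑[ t < suc n ] f (m + t)            ∎

[1+k]*[1+n]C[1+k]≡[1+n]*nCk : ∀ n k → suc k * (suc n C suc k) ≡ suc n * (n C k)
[1+k]*[1+n]C[1+k]≡[1+n]*nCk zero    zero    = refl
[1+k]*[1+n]C[1+k]≡[1+n]*nCk zero    (suc k) = *-zeroʳ (suc (suc k))
[1+k]*[1+n]C[1+k]≡[1+n]*nCk (suc n) zero    =
  trans (*-identityˡ _) (trans (nC1≡n (suc (suc n))) (sym (*-identityʳ (suc (suc n)))))
[1+k]*[1+n]C[1+k]≡[1+n]*nCk (suc n) (suc k) = begin
  suc (suc k) * (suc (suc n) C suc (suc k))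
    ≡⟨ cong (suc (suc k) *_) (nCk+nC[k+1]≡[n+1]C[k+1] (suc n) (suc k)) ⟨
  suc (suc k) * (X + Y)
    ≡⟨ regroupˡ k X Y ⟩
  suc k * X + X + suc (suc k) * Y
    ≡⟨ cong₂ (λ u v → u + X + v) ([1+k]*[1+n]C[1+k]≡[1+n]*nCk n k)
                                 ([1+k]*[1+n]C[1+k]≡[1+n]*nCk n (suc k)) ⟩
  suc n * (n C k) + X + suc n * (n C suc k)
    ≡⟨ regroupʳ n (n C k) (n C suc k) X ⟩
  suc n * (n C k + n C suc k) + X
    ≡⟨ cong (λ u → suc n * u + X) (nCk+nC[k+1]≡[n+1]C[k+1] n k) ⟩
  suc n * X + X
    ≡⟨ +-comm (suc n * X) X ⟩
  suc (suc n) * X ∎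
  where
  X = suc n C suc k
  Y = suc n C suc (suc k)
  regroupˡ : ∀ k x y → suc (suc k) * (x + y) ≡ suc k * x + x + suc (suc k) * y
  regroupˡ = solve-∀
  regroupʳ : ∀ n p q x → suc n * p + x + suc n * q ≡ suc n * (p + q) + x
  regroupʳ = solve-∀

[n∸k]*nCk≡[1+k]*nC[1+k] : ∀ n k → (n ∸ k) * (n C k) ≡ suc k * (n C suc k)
[n∸k]*nCk≡[1+k]*nC[1+k] n k with k ≤? n
... | no k≰n = begin
  (n ∸ k) * (n C k)     ≡⟨ cong (_* (n C k)) (m≤n⇒m∸n≡0 (≰⇒≥ k≰n)) ⟩
  0                     ≡⟨ *-zeroʳ (suc k) ⟨
  suc k * 0             ≡⟨ cong (suc k *_) (k>n⇒nCk≡0 (m<n⇒m<1+n (≰⇒> k≰n))) ⟨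
  suc k * (n C suc k)   ∎
... | yes k≤n = +-cancelʳ-≡ (suc k * (n C k)) _ _ (begin
  (n ∸ k) * (n C k) + suc k * (n C k)        ≡⟨ *-distribʳ-+ (n C k) (n ∸ k) (suc k) ⟨
  ((n ∸ k) + suc k) * (n C k)                ≡⟨ cong (_* (n C k)) [n∸k]+[1+k]≡1+n ⟩
  suc n * (n C k)                            ≡⟨ [1+k]*[1+n]C[1+k]≡[1+n]*nCk n k ⟨
  suc k * (suc n C suc k)                    ≡⟨ cong (suc k *_) (nCk+nC[k+1]≡[n+1]C[k+1] n k) ⟨
  suc k * (n C k + n C suc k)                ≡⟨ *-distribˡ-+ (suc k) (n C k) (n C suc k) ⟩
  suc k * (n C k) + suc k * (n C suc k)      ≡⟨ +-comm (suc k * (n C k)) _ ⟩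
  suc k * (n C suc k) + suc k * (n C k)      ∎)
  where
  [n∸k]+[1+k]≡1+n : (n ∸ k) + suc k ≡ suc n
  [n∸k]+[1+k]≡1+n = trans (+-suc (n ∸ k) k) (cong suc (m∸n+n≡m k≤n))

nCk*[k!*[n∸k]!]≡n! : ∀ {n k} → k ≤ n → (n C k) * (k ! * (n ∸ k) !) ≡ n !
nCk*[k!*[n∸k]!]≡n! {n} {k} k≤n = trans
  (cong (_* (k ! * (n ∸ k) !)) (nCk≡n!/k![n-k]! k≤n))
  (m/n*n≡m {{k !* (n ∸ k) !≢0}} (k![n∸k]!∣n! k≤n))

-- Both sides are (j+m)! / (i! j! (m-i)!).
[j+i]Ci*[j+m]C[j+i]≡[j+m]Cm*mCi : ∀ j {i m} → i ≤ m →
  ((j + i) C i) * ((j + m) C (j + i)) ≡ ((j + m) C m) * (m C i)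
[j+i]Ci*[j+m]C[j+i]≡[j+m]Cm*mCi j {i} {m} i≤m =
  *-cancelʳ-≡ _ _ (i ! * (j ! * (m ∸ i) !)) {{m*n≢0 _ _ {{i !≢0}} {{j !* (m ∸ i) !≢0}}}}
    (trans lhs≡[j+m]! (sym rhs≡[j+m]!))
  where
  [j+i]∸i≡j : (j + i) ∸ i ≡ j
  [j+i]∸i≡j = m+n∸n≡m j i
  [j+m]∸m≡j : (j + m) ∸ m ≡ j
  [j+m]∸m≡j = m+n∸n≡m j m
  [j+m]∸[j+i]≡m∸i : (j + m) ∸ (j + i) ≡ m ∸ i
  [j+m]∸[j+i]≡m∸i = [m+n]∸[m+o]≡n∸o j m i
  regroupˡ : ∀ x y a b c → x * y * (a * (b * c)) ≡ y * ((x * (a * b)) * c)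
  regroupˡ = solve-∀
  regroupʳ : ∀ x y a b c → x * y * (a * (b * c)) ≡ x * ((y * (a * c)) * b)
  regroupʳ = solve-∀
  lhs≡[j+m]! : ((j + i) C i) * ((j + m) C (j + i)) * (i ! * (j ! * (m ∸ i) !)) ≡ (j + m) !
  lhs≡[j+m]! = begin
    ((j + i) C i) * ((j + m) C (j + i)) * (i ! * (j ! * (m ∸ i) !))
      ≡⟨ regroupˡ ((j + i) C i) _ (i !) (j !) ((m ∸ i) !) ⟩
    ((j + m) C (j + i)) * (((j + i) C i) * (i ! * j !) * (m ∸ i) !)
      ≡⟨ cong (λ z → ((j + m) C (j + i)) * (((j + i) C i) * (i ! * z !) * (m ∸ i) !)) [j+i]∸i≡j ⟨
    ((j + m) C (j + i)) * (((j + i) C i) * (i ! * ((j + i) ∸ i) !) * (m ∸ i) !)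
      ≡⟨ cong (λ z → ((j + m) C (j + i)) * (z * (m ∸ i) !)) (nCk*[k!*[n∸k]!]≡n! (m≤n+m i j)) ⟩
    ((j + m) C (j + i)) * ((j + i) ! * (m ∸ i) !)
      ≡⟨ cong (λ z → ((j + m) C (j + i)) * ((j + i) ! * z !)) [j+m]∸[j+i]≡m∸i ⟨
    ((j + m) C (j + i)) * ((j + i) ! * ((j + m) ∸ (j + i)) !)
      ≡⟨ nCk*[k!*[n∸k]!]≡n! (+-monoʳ-≤ j i≤m) ⟩
    (j + m) ! ∎
  rhs≡[j+m]! : ((j + m) C m) * (m C i) * (i ! * (j ! * (m ∸ i) !)) ≡ (j + m) !
  rhs≡[j+m]! = begin
    ((j + m) C m) * (m C i) * (i ! * (j ! * (m ∸ i) !))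
      ≡⟨ regroupʳ ((j + m) C m) (m C i) (i !) (j !) ((m ∸ i) !) ⟩
    ((j + m) C m) * ((m C i) * (i ! * (m ∸ i) !) * j !)
      ≡⟨ cong (λ z → ((j + m) C m) * (z * j !)) (nCk*[k!*[n∸k]!]≡n! i≤m) ⟩
    ((j + m) C m) * (m ! * j !)
      ≡⟨ cong (λ z → ((j + m) C m) * (m ! * z !)) [j+m]∸m≡j ⟨
    ((j + m) C m) * (m ! * ((j + m) ∸ m) !)
      ≡⟨ nCk*[k!*[n∸k]!]≡n! (m≤n+m m j) ⟩
    (j + m) ! ∎

∑[1+n]Ct≡∑nCt+∑nCt : ∀ n N → ∑[ t < suc N ] (suc n C t) ≡ ∑[ t < suc N ] (n C t) + ∑[ t < N ] (n C t)
∑[1+n]Ct≡∑nCt+∑nCt n zero    = refl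
∑[1+n]Ct≡∑nCt+∑nCt n (suc N) = begin
  ∑[ t < suc N ] (suc n C t) + suc n C suc N
    ≡⟨ cong₂ _+_ (∑[1+n]Ct≡∑nCt+∑nCt n N) (sym (nCk+nC[k+1]≡[n+1]C[k+1] n N)) ⟩
  ∑[ t < suc N ] (n C t) + ∑[ t < N ] (n C t) + (n C N + n C suc N)
    ≡⟨ regroup (∑[ t < suc N ] (n C t)) (∑[ t < N ] (n C t)) (n C N) (n C suc N) ⟩
  ∑[ t < suc N ] (n C t) + n C suc N + (∑[ t < N ] (n C t) + n C N) ∎
  where
  regroup : ∀ s s′ x y → s + s′ + (x + y) ≡ s + y + (s′ + x)
  regroup = solve-∀

∑nCt≡2^n : ∀ n → ∑[ t < suc n ] (n C t) ≡ 2 ^ n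
∑nCt≡2^n zero    = refl
∑nCt≡2^n (suc n) = begin
  ∑[ t < suc (suc n) ] (suc n C t)                      ≡⟨ ∑[1+n]Ct≡∑nCt+∑nCt n (suc n) ⟩
  ∑[ t < suc n ] (n C t) + n C suc n + ∑[ t < suc n ] (n C t)
    ≡⟨ cong (λ x → ∑[ t < suc n ] (n C t) + x + ∑[ t < suc n ] (n C t)) (k>n⇒nCk≡0 (n<1+n n)) ⟩
  ∑[ t < suc n ] (n C t) + 0 + ∑[ t < suc n ] (n C t)
    ≡⟨ cong (λ s → s + 0 + s) (∑nCt≡2^n n) ⟩
  2 ^ n + 0 + 2 ^ n                                     ≡⟨ cong (_+ 2 ^ n) (+-identityʳ (2 ^ n)) ⟩
  2 ^ n + 2 ^ n                                         ≡⟨ cong (λ x → 2 ^ n + x) (+-identityʳ (2 ^ n)) ⟨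
  2 ^ suc n                                             ∎

∑[m∸2t]*mCt≡N*mCN : ∀ m N → N ≤ suc ⌊ m /2⌋ → ∑[ t < N ] ((m ∸ 2 * t) * (m C t)) ≡ N * (m C N)
∑[m∸2t]*mCt≡N*mCN m zero    _         = refl
∑[m∸2t]*mCt≡N*mCN m (suc N) (s≤s N≤f) = begin
  ∑[ t < N ] ((m ∸ 2 * t) * (m C t)) + (m ∸ 2 * N) * (m C N)
    ≡⟨ cong (_+ (m ∸ 2 * N) * (m C N)) (∑[m∸2t]*mCt≡N*mCN m N (m≤n⇒m≤1+n N≤f)) ⟩
  N * (m C N) + (m ∸ 2 * N) * (m C N)   ≡⟨ *-distribʳ-+ (m C N) N (m ∸ 2 * N) ⟨
  (N + (m ∸ 2 * N)) * (m C N)           ≡⟨ cong (_* (m C N)) N+[m∸2N]≡m∸N ⟩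
  (m ∸ N) * (m C N)                     ≡⟨ [n∸k]*nCk≡[1+k]*nC[1+k] m N ⟩
  suc N * (m C suc N)                   ∎
  where
  N+N≤m : N + N ≤ m
  N+N≤m = ≤-trans (≤-reflexive (sym (2*m≡m+m N))) (≤-trans (*-monoʳ-≤ 2 N≤f) (2*⌊n/2⌋≤n m))
  N+[m∸2N]≡m∸N : N + (m ∸ 2 * N) ≡ m ∸ N
  N+[m∸2N]≡m∸N = begin
    N + (m ∸ 2 * N)        ≡⟨ cong (λ x → N + (m ∸ x)) (2*m≡m+m N) ⟩
    N + (m ∸ (N + N))      ≡⟨ cong (_+_ N) (∸-+-assoc m N N) ⟨
    N + (m ∸ N ∸ N)        ≡⟨ m+[n∸m]≡n (m+n≤o⇒m≤o∸n N N+N≤m) ⟩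
    m ∸ N                  ∎

∑[m∸2t]*mCt≡⌈m/2⌉*mC⌈m/2⌉ : ∀ m →
  ∑[ t < suc ⌊ m /2⌋ ] ((m ∸ 2 * t) * (m C t)) ≡ ⌈ m /2⌉ * (m C ⌈ m /2⌉)
∑[m∸2t]*mCt≡⌈m/2⌉*mC⌈m/2⌉ m = begin
  ∑[ t < suc ⌊ m /2⌋ ] ((m ∸ 2 * t) * (m C t))  ≡⟨ ∑[m∸2t]*mCt≡N*mCN m (suc ⌊ m /2⌋) ≤-refl ⟩
  suc ⌊ m /2⌋ * (m C suc ⌊ m /2⌋)               ≡⟨ [n∸k]*nCk≡[1+k]*nC[1+k] m ⌊ m /2⌋ ⟨
  (m ∸ ⌊ m /2⌋) * (m C ⌊ m /2⌋)                 ≡⟨ cong (_* (m C ⌊ m /2⌋)) (n∸⌊n/2⌋≡⌈n/2⌉ m) ⟩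
  ⌈ m /2⌉ * (m C ⌊ m /2⌋)                       ≡⟨ cong (_*_ ⌈ m /2⌉) (nCk≡nC[n∸k] (⌊n/2⌋≤n m)) ⟩
  ⌈ m /2⌉ * (m C (m ∸ ⌊ m /2⌋))                 ≡⟨ cong (λ i → ⌈ m /2⌉ * (m C i)) (n∸⌊n/2⌋≡⌈n/2⌉ m) ⟩
  ⌈ m /2⌉ * (m C ⌈ m /2⌉)                       ∎

2^n≡∑[t<⌈n/2⌉]nCt+∑[t≤⌊n/2⌋]nCt : ∀ n →
  2 ^ n ≡ ∑[ t < ⌈ n /2⌉ ] (n C t) + ∑[ t < suc ⌊ n /2⌋ ] (n C t)
2^n≡∑[t<⌈n/2⌉]nCt+∑[t≤⌊n/2⌋]nCt n = begin
  2 ^ n                                                  ≡⟨ ∑nCt≡2^n n ⟨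
  ∑[ t < suc n ] (n C t)                                 ≡⟨ cong (λ N → ∑[ t < N ] (n C t)) 1+n≡c+[1+f] ⟩
  ∑[ t < c + suc f ] (n C t)                             ≡⟨ ∑-split c (suc f) (_C_ n) ⟩
  ∑[ t < c ] (n C t) + ∑[ t < suc f ] (n C (c + t))      ≡⟨ cong (_+_ (∑[ t < c ] (n C t))) upper-half ⟩
  ∑[ t < c ] (n C t) + ∑[ t < suc f ] (n C t)            ∎
  where
  c = ⌈ n /2⌉
  f = ⌊ n /2⌋
  1+n≡c+[1+f] : suc n ≡ c + suc f
  1+n≡c+[1+f] = sym (trans (+-suc c f) (cong suc (trans (+-comm c f) (⌊n/2⌋+⌈n/2⌉≡n n))))
  c+[f∸t]≡n∸t : ∀ {t} → t ≤ f → c + (f ∸ t) ≡ n ∸ t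
  c+[f∸t]≡n∸t {t} t≤f = begin
    c + (f ∸ t)   ≡⟨ +-∸-assoc c t≤f ⟨
    c + f ∸ t     ≡⟨ cong (_∸ t) (trans (+-comm c f) (⌊n/2⌋+⌈n/2⌉≡n n)) ⟩
    n ∸ t         ∎
  upper-half : ∑[ t < suc f ] (n C (c + t)) ≡ ∑[ t < suc f ] (n C t)
  upper-half = trans (∑-reverse (suc f) (λ t → n C (c + t))) (∑-cong (suc f) λ t t≤f →
    trans (cong (λ i → n C i) (c+[f∸t]≡n∸t (s≤s⁻¹ t≤f)))
          (sym (nCk≡nC[n∸k] (≤-trans (s≤s⁻¹ t≤f) (⌊n/2⌋≤n n)))))

2*∑[n∸1∸2t]*nCt+2^n≡[1+n]*nC⌈n/2⌉ : ∀ n →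
  2 * ∑[ t < ⌈ n /2⌉ ] ((n ∸ suc (2 * t)) * (n C t)) + 2 ^ n ≡ suc n * (n C ⌈ n /2⌉)
2*∑[n∸1∸2t]*nCt+2^n≡[1+n]*nC⌈n/2⌉ n = [ even , odd ]′ (⌈n/2⌉≡⌊n/2⌋⊎⌈n/2⌉≡1+⌊n/2⌋ n)
  where
  c = ⌈ n /2⌉
  f = ⌊ n /2⌋
  S = ∑[ t < c ] ((n ∸ suc (2 * t)) * (n C t))
  H : ℕ → ℕ
  H N = ∑[ t < N ] (n C t)

  S+H≡c*nCc : S + H c ≡ c * (n C c)
  S+H≡c*nCc = begin
    S + H c
      ≡⟨ ∑-distrib-+ c (λ t → (n ∸ suc (2 * t)) * (n C t)) (_C_ n) ⟨
    ∑[ t < c ] ((n ∸ suc (2 * t)) * (n C t) + n C t)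
      ≡⟨ ∑-cong c (λ t t<c → lower-by-one {t} (t<⌈n/2⌉⇒1+2t≤n t<c)) ⟩
    ∑[ t < c ] ((n ∸ 2 * t) * (n C t))
      ≡⟨ ∑[m∸2t]*mCt≡N*mCN n c (⌈n/2⌉≤1+⌊n/2⌋ n) ⟩
    c * (n C c) ∎
    where
    lower-by-one : ∀ {t} → suc (2 * t) ≤ n → (n ∸ suc (2 * t)) * (n C t) + n C t ≡ (n ∸ 2 * t) * (n C t)
    lower-by-one {t} 1+2t≤n = trans (+-comm _ (n C t)) (cong (_* (n C t)) (sym (+-∸-assoc 1 1+2t≤n)))

  even : c ≡ f → 2 * S + 2 ^ n ≡ suc n * (n C c)
  even c≡f = begin
    2 * S + 2 ^ n                  ≡⟨ cong (λ x → 2 * S + x) (2^n≡∑[t<⌈n/2⌉]nCt+∑[t≤⌊n/2⌋]nCt n) ⟩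
    2 * S + (H c + H (suc f))      ≡⟨ cong (λ N → 2 * S + (H c + H (suc N))) c≡f ⟨
    2 * S + (H c + (H c + n C c))  ≡⟨ regroup S (H c) (n C c) ⟩
    2 * (S + H c) + n C c          ≡⟨ cong (λ x → 2 * x + n C c) S+H≡c*nCc ⟩
    2 * (c * (n C c)) + n C c      ≡⟨ regroup′ c (n C c) ⟩
    suc (c + c) * (n C c)          ≡⟨ cong (λ x → suc x * (n C c)) c+c≡n ⟩
    suc n * (n C c)                ∎
    where
    regroup : ∀ s h x → 2 * s + (h + (h + x)) ≡ 2 * (s + h) + x
    regroup = solve-∀
    regroup′ : ∀ c x → 2 * (c * x) + x ≡ suc (c + c) * x
    regroup′ = solve-∀
    c+c≡n : c + c ≡ n
    c+c≡n = trans (cong (_+ c) c≡f) (⌊n/2⌋+⌈n/2⌉≡n n)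

  odd : c ≡ suc f → 2 * S + 2 ^ n ≡ suc n * (n C c)
  odd c≡1+f = begin
    2 * S + 2 ^ n                  ≡⟨ cong (λ x → 2 * S + x) (2^n≡∑[t<⌈n/2⌉]nCt+∑[t≤⌊n/2⌋]nCt n) ⟩
    2 * S + (H c + H (suc f))      ≡⟨ cong (λ N → 2 * S + (H c + H N)) c≡1+f ⟨
    2 * S + (H c + H c)            ≡⟨ regroup S (H c) ⟩
    2 * (S + H c)                  ≡⟨ cong (_*_ 2) S+H≡c*nCc ⟩
    2 * (c * (n C c))              ≡⟨ regroup′ c (n C c) ⟩
    (c + c) * (n C c)              ≡⟨ cong (_* (n C c)) c+c≡1+n ⟩
    suc n * (n C c)                ∎
    where
    regroup : ∀ s h → 2 * s + (h + h) ≡ 2 * (s + h)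
    regroup = solve-∀
    regroup′ : ∀ c x → 2 * (c * x) ≡ (c + c) * x
    regroup′ = solve-∀
    c+c≡1+n : c + c ≡ suc n
    c+c≡1+n = trans (cong (_+ c) c≡1+f) (cong suc (⌊n/2⌋+⌈n/2⌉≡n n))

j+j+m∸2[j+t]≡m∸2t : ∀ j m t → j + j + m ∸ 2 * (j + t) ≡ m ∸ 2 * t
j+j+m∸2[j+t]≡m∸2t j m t = begin
  j + j + m ∸ 2 * (j + t)           ≡⟨ cong (λ x → j + j + m ∸ x) (*-distribˡ-+ 2 j t) ⟩
  j + j + m ∸ (2 * j + 2 * t)       ≡⟨ cong (λ x → j + j + m ∸ (x + 2 * t)) (2*m≡m+m j) ⟩
  j + j + m ∸ (j + j + 2 * t)       ≡⟨ [m+n]∸[m+o]≡n∸o (j + j) m (2 * t) ⟩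
  m ∸ 2 * t                         ∎

j+j+m∸[j+t]≡j+[m∸t] : ∀ j {m t} → t ≤ m → j + j + m ∸ (j + t) ≡ j + (m ∸ t)
j+j+m∸[j+t]≡j+[m∸t] j {m} {t} t≤m = begin
  j + j + m ∸ (j + t)               ≡⟨ cong (_∸ (j + t)) (+-assoc j j m) ⟩
  j + (j + m) ∸ (j + t)             ≡⟨ [m+n]∸[m+o]≡n∸o j (j + m) t ⟩
  j + m ∸ t                         ≡⟨ +-∸-assoc j t≤m ⟩
  j + (m ∸ t)                       ∎

summand-shift : ∀ j m M t → t ≤ m → m ∸ t ≤ M →
  (j + j + m ∸ 2 * (j + t)) * ((j + j + m ∸ (j + t)) C (j + m ∸ (j + t))) * ((j + M) C (j + j + m ∸ (j + t)))
    ≡ (m ∸ 2 * t) * (M C (m ∸ t)) * ((j + M) C M)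
summand-shift j m M t t≤m m∸t≤M
  rewrite j+j+m∸2[j+t]≡m∸2t j m t | j+j+m∸[j+t]≡j+[m∸t] j t≤m | [m+n]∸[m+o]≡n∸o j m t = begin
  (m ∸ 2 * t) * ((j + i) C i) * ((j + M) C (j + i))
    ≡⟨ *-assoc (m ∸ 2 * t) _ _ ⟩
  (m ∸ 2 * t) * (((j + i) C i) * ((j + M) C (j + i)))
    ≡⟨ cong (_*_ (m ∸ 2 * t)) ([j+i]Ci*[j+m]C[j+i]≡[j+m]Cm*mCi j m∸t≤M) ⟩
  (m ∸ 2 * t) * (((j + M) C M) * (M C i))
    ≡⟨ regroup (m ∸ 2 * t) ((j + M) C M) (M C i) ⟩
  (m ∸ 2 * t) * (M C i) * ((j + M) C M) ∎
  where
  i = m ∸ t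
  regroup : ∀ x y z → x * (y * z) ≡ x * z * y
  regroup = solve-∀

j+j+m∸[j+m]≡j : ∀ j m → j + j + m ∸ (j + m) ≡ j
j+j+m∸[j+m]≡j j m = trans (cong (_∸ (j + m)) (regroup j m)) (m+n∸m≡n (j + m) j)
  where
  regroup : ∀ j m → j + j + m ≡ j + m + j
  regroup = solve-∀

2*[j+m]∸[j+j+m]≡m : ∀ j m → 2 * (j + m) ∸ (j + j + m) ≡ m
2*[j+m]∸[j+j+m]≡m j m = trans (cong (_∸ (j + j + m)) (regroup j m)) (m+n∸m≡n (j + j + m) m)
  where
  regroup : ∀ j m → 2 * (j + m) ≡ j + j + m + m
  regroup = solve-∀

m+[1+n]∸1≡m+n : ∀ m n → m + suc n ∸ 1 ≡ m + n
m+[1+n]∸1≡m+n m n = cong (_∸ 1) (+-suc m n)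

k≤a≤2k⇒a≡j+j+m×k≡j+m : ∀ {a k} → k ≤ a → a ≤ 2 * k →
  a ≡ (a ∸ k) + (a ∸ k) + (2 * k ∸ a) × k ≡ (a ∸ k) + (2 * k ∸ a)
k≤a≤2k⇒a≡j+j+m×k≡j+m {a} {k} k≤a a≤2k = a≡j+j+m , k≡j+m
  where
  j = a ∸ k
  m = 2 * k ∸ a
  k+j≡a : k + j ≡ a
  k+j≡a = m+[n∸m]≡n k≤a
  j≤k : j ≤ k
  j≤k = +-cancelˡ-≤ k j k (≤-trans (≤-reflexive k+j≡a) (≤-trans a≤2k (≤-reflexive (2*m≡m+m k))))
  k≡j+m : k ≡ j + m
  k≡j+m = begin
    k                  ≡⟨ m+[n∸m]≡n j≤k ⟨
    j + (k ∸ j)        ≡⟨ cong (_+_ j) ([m+n]∸[m+o]≡n∸o k k j) ⟨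
    j + (k + k ∸ (k + j))  ≡⟨ cong₂ (λ x y → j + (x ∸ y)) (2*m≡m+m k) (sym k+j≡a) ⟨
    j + m              ∎
  a≡j+j+m : a ≡ j + j + m
  a≡j+j+m = begin
    a                  ≡⟨ k+j≡a ⟨
    k + j              ≡⟨ cong (_+ j) k≡j+m ⟩
    j + m + j          ≡⟨ regroup j m ⟩
    j + j + m          ∎
    where
    regroup : ∀ j m → j + m + j ≡ j + j + m
    regroup = solve-∀

Identity-a : ℕ → ℕ → Set
Identity-a a k =
  sumFromTo (λ x → (a ∸ 2 * x) * ((a ∸ x) C (k ∸ x)) * (k C (a ∸ x))) (a ∸ k) ⌊ a /2⌋
    ≡ ⌈ (2 * k ∸ a) /2⌉ * ((2 * k ∸ a) C ⌈ (2 * k ∸ a) /2⌉) * (k C (2 * k ∸ a))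

Identity-b : ℕ → ℕ → Set
Identity-b a k =
  (+ sumFromTo (λ x → (a ∸ 2 * x) * ((a ∸ x) C (k ∸ x)) * ((k ∸ 1) C (a ∸ x))) (a ∸ k + 1) ⌊ a /2⌋) / 1
    ≡ (((+ (2 * k ∸ a)) / 2) *ℚ ((+ ((2 * k ∸ a ∸ 1) C ⌈ (2 * k ∸ a ∸ 1) /2⌉)) / 1)
        - (+ (2 ^ (2 * k ∸ a ∸ 2))) / 1)
      *ℚ ((+ ((k ∸ 1) C (2 * k ∸ a ∸ 1))) / 1)

-- Part (b) times 2, with 2^(m-2) C(k-1,m-1) moved to the left: a statement about ℕ alone.
Identity-b-cleared : ℕ → ℕ → Set
Identity-b-cleared a k =
  2 * sumFromTo (λ x → (a ∸ 2 * x) * ((a ∸ x) C (k ∸ x)) * ((k ∸ 1) C (a ∸ x))) (a ∸ k + 1) ⌊ a /2⌋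
    + 2 * 2 ^ (2 * k ∸ a ∸ 2) * ((k ∸ 1) C (2 * k ∸ a ∸ 1))
    ≡ (2 * k ∸ a) * ((2 * k ∸ a ∸ 1) C ⌈ (2 * k ∸ a ∸ 1) /2⌉) * ((k ∸ 1) C (2 * k ∸ a ∸ 1))

Identity-b-cleared⇒Identity-b : ∀ a k → Identity-b-cleared a k → Identity-b a k
Identity-b-cleared⇒Identity-b a k = 2T+2PB≡mDB⇒T≡[m/2*D-P]*B
  (sumFromTo (λ x → (a ∸ 2 * x) * ((a ∸ x) C (k ∸ x)) * ((k ∸ 1) C (a ∸ x))) (a ∸ k + 1) ⌊ a /2⌋)
  (2 * k ∸ a) ((2 * k ∸ a ∸ 1) C ⌈ (2 * k ∸ a ∸ 1) /2⌉) (2 ^ (2 * k ∸ a ∸ 2)) ((k ∸ 1) C (2 * k ∸ a ∸ 1))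

identity-a : ∀ j m → Identity-a (j + j + m) (j + m)
identity-a j m rewrite j+j+m∸[j+m]≡j j m | 2*[j+m]∸[j+j+m]≡m j m | ⌊j+j+m/2⌋≡j+⌊m/2⌋ j m = begin
  sumFromTo F j (j + ⌊ m /2⌋)                                   ≡⟨ sumFromTo[m,m+n]≡∑ F j ⌊ m /2⌋ ⟩
  ∑[ t < suc ⌊ m /2⌋ ] F (j + t)                                 ≡⟨ ∑-cong (suc ⌊ m /2⌋) shifted ⟩
  ∑[ t < suc ⌊ m /2⌋ ] ((m ∸ 2 * t) * (m C t) * B)               ≡⟨ ∑-distribʳ-* (suc ⌊ m /2⌋) B _ ⟩
  ∑[ t < suc ⌊ m /2⌋ ] ((m ∸ 2 * t) * (m C t)) * B               ≡⟨ cong (_* B) (∑[m∸2t]*mCt≡⌈m/2⌉*mC⌈m/2⌉ m) ⟩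
  ⌈ m /2⌉ * (m C ⌈ m /2⌉) * B                                    ∎
  where
  B = (j + m) C m
  F : ℕ → ℕ
  F x = (j + j + m ∸ 2 * x) * ((j + j + m ∸ x) C (j + m ∸ x)) * ((j + m) C (j + j + m ∸ x))
  shifted : ∀ t → t < suc ⌊ m /2⌋ → F (j + t) ≡ (m ∸ 2 * t) * (m C t) * B
  shifted t t≤⌊m/2⌋ = trans (summand-shift j m m t t≤m (m∸n≤m m t))
                            (cong (λ z → (m ∸ 2 * t) * z * B) (sym (nCk≡nC[n∸k] t≤m)))
    where
    t≤m : t ≤ m
    t≤m = ≤-trans (s≤s⁻¹ t≤⌊m/2⌋) (⌊n/2⌋≤n m)

identity-b-cleared : ∀ j n → Identity-b-cleared (j + j + suc (suc n)) (j + suc (suc n))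
identity-b-cleared j n
  rewrite j+j+m∸[j+m]≡j j (suc (suc n)) | 2*[j+m]∸[j+j+m]≡m j (suc (suc n))
        | ⌊j+j+m/2⌋≡j+⌊m/2⌋ j (suc (suc n)) | m+[1+n]∸1≡m+n j (suc n) = begin
    2 * T + 2 * 2 ^ n * B        ≡⟨ cong (λ x → 2 * x + 2 * 2 ^ n * B) T≡S*B ⟩
    2 * (S * B) + 2 * 2 ^ n * B  ≡⟨ regroup S B (2 ^ n) ⟩
    (2 * S + 2 ^ suc n) * B      ≡⟨ cong (_* B) (2*∑[n∸1∸2t]*nCt+2^n≡[1+n]*nC⌈n/2⌉ (suc n)) ⟩
    m * D * B                    ∎
  where
  m = suc (suc n)
  f = ⌊ n /2⌋
  B = (j + suc n) C suc n
  D = suc n C ⌈ suc n /2⌉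
  F : ℕ → ℕ
  F x = (j + j + m ∸ 2 * x) * ((j + j + m ∸ x) C (j + m ∸ x)) * ((j + suc n) C (j + j + m ∸ x))
  T = sumFromTo F (j + 1) (j + suc f)
  S = ∑[ u < suc f ] ((suc n ∸ suc (2 * u)) * (suc n C u))

  shifted : ∀ u → u < suc f → F (j + 1 + u) ≡ (suc n ∸ suc (2 * u)) * (suc n C u) * B
  shifted u u≤f = begin
    F (j + 1 + u)
      ≡⟨ cong F (+-assoc j 1 u) ⟩
    F (j + suc u)
      ≡⟨ summand-shift j m (suc n) (suc u) (s≤s u≤1+n) (m∸n≤m (suc n) u) ⟩
    (m ∸ 2 * suc u) * (suc n C (suc n ∸ u)) * B
      ≡⟨ cong₂ (λ x y → (m ∸ x) * y * B) (*-suc 2 u) (sym (nCk≡nC[n∸k] u≤1+n)) ⟩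
    (suc n ∸ suc (2 * u)) * (suc n C u) * B ∎
    where
    u≤1+n : u ≤ suc n
    u≤1+n = m≤n⇒m≤1+n (≤-trans (s≤s⁻¹ u≤f) (⌊n/2⌋≤n n))

  T≡S*B : T ≡ S * B
  T≡S*B = begin
    sumFromTo F (j + 1) (j + suc f)                           ≡⟨ cong (sumFromTo F (j + 1)) (+-assoc j 1 f) ⟨
    sumFromTo F (j + 1) (j + 1 + f)                           ≡⟨ sumFromTo[m,m+n]≡∑ F (j + 1) f ⟩
    ∑[ u < suc f ] F (j + 1 + u)                              ≡⟨ ∑-cong (suc f) shifted ⟩
    ∑[ u < suc f ] ((suc n ∸ suc (2 * u)) * (suc n C u) * B)  ≡⟨ ∑-distribʳ-* (suc f) B _ ⟩
    S * B                                                     ∎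

  regroup : ∀ s b p → 2 * (s * b) + 2 * p * b ≡ (2 * s + 2 * p) * b
  regroup = solve-∀

k≤a≤2k⇒Identity-a : ∀ {a k} → k ≤ a → a ≤ 2 * k → Identity-a a k
k≤a≤2k⇒Identity-a {a} {k} k≤a a≤2k =
  let a≡j+j+m , k≡j+m = k≤a≤2k⇒a≡j+j+m×k≡j+m k≤a a≤2k
  in subst₂ Identity-a (sym a≡j+j+m) (sym k≡j+m) (identity-a (a ∸ k) (2 * k ∸ a))

k≤a≤2k∸2⇒Identity-b-cleared : ∀ {a k} → k ≤ a → 2 + a ≤ 2 * k → Identity-b-cleared a k
k≤a≤2k∸2⇒Identity-b-cleared {a} {k} k≤a 2+a≤2k =
  let a≡j+j+m , k≡j+m = k≤a≤2k⇒a≡j+j+m×k≡j+m k≤a (m+n≤o⇒n≤o 2 2+a≤2k)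
  in subst₂ Identity-b-cleared (sym (trans a≡j+j+m (cong (_+_ (j + j)) m≡2+n)))
                               (sym (trans k≡j+m (cong (_+_ j) m≡2+n)))
                               (identity-b-cleared j n)
  where
  j = a ∸ k
  n = 2 * k ∸ a ∸ 2
  m≡2+n : 2 * k ∸ a ≡ 2 + n
  m≡2+n = sym (m+[n∸m]≡n (m+n≤o⇒m≤o∸n 2 2+a≤2k))

lemma8p2 : (a : ℕ) → 1 ≤ a →
    ((k : ℕ) → ⌈ a /2⌉ ≤ k → k ≤ a →
      sumFromTo (λ x → (a ∸ 2 * x) * ((a ∸ x) C (k ∸ x)) * (k C (a ∸ x))) (a ∸ k) ⌊ a /2⌋
        ≡ ⌈ (2 * k ∸ a) /2⌉ * ((2 * k ∸ a) C ⌈ (2 * k ∸ a) /2⌉) * (k C (2 * k ∸ a)))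
    ×
    ((k : ℕ) → ⌈ a /2⌉ + 1 ≤ k → k ≤ a →
      (+ sumFromTo (λ x → (a ∸ 2 * x) * ((a ∸ x) C (k ∸ x)) * ((k ∸ 1) C (a ∸ x))) (a ∸ k + 1) ⌊ a /2⌋) / 1
        ≡ (((+ (2 * k ∸ a)) / 2) *ℚ ((+ ((2 * k ∸ a ∸ 1) C ⌈ (2 * k ∸ a ∸ 1) /2⌉)) / 1)
            - (+ (2 ^ (2 * k ∸ a ∸ 2))) / 1)
          *ℚ ((+ ((k ∸ 1) C (2 * k ∸ a ∸ 1))) / 1))
lemma8p2 a _ =
  (λ k ⌈a/2⌉≤k k≤a → k≤a≤2k⇒Identity-a k≤a (⌈n/2⌉≤k⇒n≤2*k ⌈a/2⌉≤k)) ,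
  (λ k ⌈a/2⌉+1≤k k≤a → Identity-b-cleared⇒Identity-b a k
                         (k≤a≤2k∸2⇒Identity-b-cleared k≤a (⌈n/2⌉+1≤k⇒2+n≤2*k ⌈a/2⌉+1≤k)))
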